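{- Let $G$ be a finite simple undirected graph and let $\mathcal{M}$ be a given MCB of $G$. (i) If $C_2\in\mathcal{M}$, $C_1\in\mathcal{C}_{\mathcal{R}}\setminus\mathcal{M}$, $C_2\in\mathcal{E}_{\mathcal{M}}(C_1)$ and $|C_1|=|C_2|$, then $C_1\sim_{\mathtt{pi}}C_2$. (ii) The equivalence classes of $\sim_{\mathtt{pi}}$ on $\mathcal{C}_{\mathcal{R}}$ coincide with the equivalence classes of the transitive closure of these relations, i.e., of the smallest equivalence relation on $\mathcal{C}_{\mathcal{R}}$ containing all pairs $(C_1,C_2)$ with $C_1\in\mathcal{C}_{\mathcal{R}}\setminus\mathcal{M}$, $C_2\in\mathcal{M}\cap\mathcal{E}_{\mathcal{M}}(C_1)$ and $|C_1|=|C_2|$.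
   Context: Let $G=(V,E)$ be a finite simple undirected graph. A cycle is a set $C\subseteq E$ such that every vertex of $G$ has even degree in the subgraph with edge set $C$; $|C|$ denotes the number of edges. The cycles form a vector space over $GF(2)$ with addition the symmetric difference $\oplus$. A cycle basis is a basis of this space; a minimum cycle basis (MCB) is a cycle basis $\mathcal{M}$ minimizing $\sum_{B\in\mathcal{M}}|B|$. The set of relevant cycles $\mathcal{C}_{\mathcal{R}}$ is the union of all MCBs. For a cycle basis $\mathcal{B}$ and a cycle $C$, the expansion $\mathcal{E}_{\mathcal{B}}(C)$ is the unique subset of $\mathcal{B}$ whose $\oplus$-sum is $C$. For $C_1,C_2\in\mathcal{C}_{\mathcal{R}}$, $C_1\sim_{\mathtt{pi}}C_2$ means there exists an MCB $\mathcal{M}_2$ with $C_2\in\mathcal{M}_2$ such that $(\mathcal{M}_2\setminus\{C_2\})\cup\{C_1\}$ is also an MCB; this is an equivalence relation on $\mathcal{C}_{\mathcal{R}}$. -}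

module Defs where

open import Data.Nat using (ℕ; zero; suc; _≤_)
open import Data.Nat.Divisibility using (_∣_)
open import Data.Bool using (Bool; true; false; _xor_; _∧_; _∨_; if_then_else_)
open import Data.Fin using (Fin; zero; suc)
open import Data.Fin.Subset using (Subset; ∣_∣) renaming (⊥ to ∅)
open import Data.Vec using (Vec; lookup; tabulate; zipWith)
open import Data.List using (List; []; _∷_; length; map; _++_)
open import Data.Nat.ListAction using (sum)
open import Data.List.Membership.Propositional using (_∈_)
open import Data.List.Relation.Unary.All using (All)
open import Data.Product using (_×_; _,_; proj₁; proj₂; ∃; ∃-syntax; Σ)
open import Data.Sum using (_⊎_)
open import Relation.Binary.PropositionalEquality using (_≡_; _≢_)
open import Relation.Nullary using (¬_)
open import Relation.Nullary.Decidable using (⌊_⌋)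
open import Relation.Binary.Construct.Closure.Equivalence using (EqClosure)
import Data.Fin as F

record Graph : Set where
  field
    n m  : ℕ
    ends : Fin m → Fin n × Fin n
    loopless : ∀ e → proj₁ (ends e) ≢ proj₂ (ends e)
    noParallel : ∀ e e' →
      ((proj₁ (ends e) ≡ proj₁ (ends e') × proj₂ (ends e) ≡ proj₂ (ends e')) ⊎
       (proj₁ (ends e) ≡ proj₂ (ends e') × proj₂ (ends e) ≡ proj₁ (ends e'))) →
      e ≡ e'

module _ (G : Graph) where
  open Graph G

  -- edge sets (subsets of E), i.e. vectors over GF(2)
  EdgeSet : Set
  EdgeSet = Subset m

  _⊕_ : EdgeSet → EdgeSet → EdgeSet
  _⊕_ = zipWith _xor_

  incident : Fin n → Fin m → Bool
  incident v e = ⌊ v F.≟ proj₁ (ends e) ⌋ ∨ ⌊ v F.≟ proj₂ (ends e) ⌋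

  degree : EdgeSet → Fin n → ℕ
  degree C v = ∣ tabulate (λ e → lookup C e ∧ incident v e) ∣

  IsCycle : EdgeSet → Set
  IsCycle C = ∀ v → 2 ∣ degree C v

  sumSel : (B : List EdgeSet) → (Fin (length B) → Bool) → EdgeSet
  sumSel [] s = ∅
  sumSel (x ∷ xs) s = (if s zero then x else ∅) ⊕ sumSel xs (λ i → s (suc i))

  Independent : List EdgeSet → Set
  Independent B = ∀ s → sumSel B s ≡ ∅ → ∀ i → s i ≡ false

  Spans : List EdgeSet → Set
  Spans B = ∀ C → IsCycle C → ∃[ s ] sumSel B s ≡ C

  -- a cycle basis, given as a (duplicate-free, by independence) list of cycles
  IsCycleBasis : List EdgeSet → Set
  IsCycleBasis B = All IsCycle B × Independent B × Spans B

  weight : List EdgeSet → ℕ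
  weight B = sum (map ∣_∣ B)

  IsMCB : List EdgeSet → Set
  IsMCB B = IsCycleBasis B × (∀ B' → IsCycleBasis B' → weight B ≤ weight B')

  Relevant : EdgeSet → Set
  Relevant C = ∃[ M ] IsMCB M × C ∈ M

  -- D ∈ E_B(C): D belongs to the (unique) subset of B whose ⊕-sum is C
  InExpansion : List EdgeSet → EdgeSet → EdgeSet → Set
  InExpansion B C D =
    ∃[ s ] sumSel B s ≡ C × ∃[ i ] lookupL B i ≡ D × s i ≡ true
    where
      lookupL : (B : List EdgeSet) → Fin (length B) → EdgeSet
      lookupL (x ∷ xs) zero = x
      lookupL (x ∷ xs) (suc i) = lookupL xs i

  -- C₁ ∼pi C₂: some MCB M₂ ∋ C₂ such that (M₂ ∖ {C₂}) ∪ {C₁} is an MCB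
  _∼pi_ : EdgeSet → EdgeSet → Set
  C₁ ∼pi C₂ =
    ∃[ xs ] ∃[ ys ] IsMCB (xs ++ C₂ ∷ ys) × IsMCB (xs ++ C₁ ∷ ys)

  Gen : List EdgeSet → EdgeSet → EdgeSet → Set
  Gen M C₁ C₂ = Relevant C₁ × ¬ (C₁ ∈ M) × C₂ ∈ M × InExpansion M C₁ C₂ × ∣ C₁ ∣ ≡ ∣ C₂ ∣

  GenClosure : List EdgeSet → EdgeSet → EdgeSet → Set
  GenClosure M = EqClosure (Gen M)

-- Replacing a basis element b p by a vector x whose expansion uses b p gives a basis again,
-- and when |x| = |b p| the weight is unchanged, so MCBs go to MCBs: this is (i).
-- For ∼pi ⇒ closure let N and N[p := C] be MCBs and w = |C|. Restrict M-expansions to the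
-- M-cycles of length w. The restricted expansions of the N-cycles used by C add up to that of C,
-- every support point is joined to its cycle by a generating pair, and no subfamily containing
-- N p has empty restricted expansion, since otherwise N p would be a sum of shorter cycles.
-- Absorbing overlapping supports one at a time then links N p to C.
-- For closure ⇒ ∼pi, a generating path x, y₁, y₂, … with at least two edges is shortened,
-- possibly after exchanging, in the MCB, the basis end of its first edge for the other end:
-- either the rest of the path survives the exchange and the new MCB has the pair x, y₂, or some
-- later vertex is already within two steps of x. The induction ends with a single pair, i.e. (i).

module Submission where

open import Defs hiding (_⊕_)
open import Data.Fin.Subset using (∣_∣)
open import Data.List.Membership.Propositional using (_∈_)
open import Data.Product using (_×_)
open import Relation.Binary.PropositionalEquality using (_≡_)
open import Relation.Nullary using (¬_)
open import Data.List using (List; []; _∷_; length; _++_; _[_]∷=_)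
import Data.List as List
import Data.List.Properties as Listₚ
import Data.List.Membership.Propositional.Properties as ∈ₚ
import Data.List.Relation.Unary.Any as Any
import Data.List.Relation.Unary.Any.Properties as Anyₚ
open import Function.Bundles using (_⇔_; mk⇔; Equivalence)
import Data.List.Relation.Unary.All as All

open import Algebra.Bundles using (CommutativeMonoid)
open import Algebra.Structures using (IsCommutativeMonoid)
import Algebra.Properties.CommutativeMonoid.Sum as CommutativeMonoidSum
import Algebra.Solver.CommutativeMonoid as CommutativeMonoidSolver
open import Data.Bool using (Bool; true; false; _xor_; _∧_; if_then_else_)
import Data.Bool.Properties as Boolₚ
open import Data.Fin using (Fin; zero; suc; punchIn; cast)
import Data.Fin.Properties as Finₚ
open import Data.Fin.Subset using (Subset; ⁅_⁆; _∩_) renaming (⊥ to ∅)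
import Data.Fin.Subset.Properties as Subsetₚ
open import Data.Nat using (ℕ; zero; suc; _+_; _≤_; _<_; _≡ᵇ_; z≤n; s≤s)
import Data.Nat.Properties as ℕₚ
open import Data.Product using (Σ-syntax; ∃-syntax; _,_; proj₁; proj₂)
open import Data.Sum using (_⊎_; inj₁; inj₂; [_,_]′)
open import Data.Vec using ([]; _∷_; lookup; zipWith; tabulate; insertAt)
import Data.Vec.Properties as Vecₚ
open import Data.Vec.Functional using (updateAt; removeAt)
import Data.Vec.Functional.Properties as Vectorₚ
import Function.Properties.Equivalence as ⇔
open import Function using (_∘_; const)
open import Level using (0ℓ)
open import Relation.Binary.Bundles using (Setoid)
open import Relation.Binary.Definitions using (DecidableEquality)
import Relation.Binary.Construct.Closure.Equivalence as EQ
open import Relation.Binary.Construct.Closure.ReflexiveTransitive using (ε; _◅_; _◅◅_)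
open import Relation.Binary.Construct.Closure.Symmetric using (SymClosure; fwd; bwd)
open import Relation.Binary.PropositionalEquality
  using (_≢_; _≗_; refl; sym; trans; cong; cong₂; subst; module ≡-Reasoning)
import Relation.Binary.PropositionalEquality.Algebra as ≡-Algebra
open import Relation.Nullary using (contradiction; yes; no; Dec)
open import Relation.Nullary.Decidable using (_⊎-dec_; _×-dec_)

private
  variable
    n k : ℕ

module SumProperties {A : Set} {_∙_ : A → A → A} {ε : A}
  (isCM : IsCommutativeMonoid _≡_ _∙_ ε) where

  private
    M : CommutativeMonoid 0ℓ 0ℓ
    M = record { isCommutativeMonoid = isCM }
  open CommutativeMonoidSum M public
    using (sum; sum-cong-≗; sum-remove; sum-replicate-zero; ∑-distrib-+)
  open CommutativeMonoidSolver M using (solve; _⊕_; _⊜_)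

  sum-zero : {f : Fin n → A} → (∀ i → f i ≡ ε) → sum f ≡ ε
  sum-zero {n} f≗ε = trans (sum-cong-≗ f≗ε) (sum-replicate-zero n)

  sum-single : {f : Fin n → A} (p : Fin n) → (∀ i → i ≢ p → f i ≡ ε) → sum f ≡ f p
  sum-single {suc n} {f} p f≗ε = begin
    sum f                        ≡⟨ sum-remove f ⟩
    f p ∙ sum (removeAt f p)     ≡⟨ cong (f p ∙_) (sum-zero (λ i → f≗ε _ (Finₚ.punchInᵢ≢i p i))) ⟩
    f p ∙ ε                      ≡⟨ IsCommutativeMonoid.identityʳ isCM (f p) ⟩
    f p                          ∎
    where open ≡-Reasoning

  sum-update : {f g : Fin n → A} (p : Fin n) → (∀ i → i ≢ p → f i ≡ g i) →
               sum f ∙ g p ≡ sum g ∙ f p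
  sum-update {suc n} {f} {g} p f≗g = begin
    sum f ∙ g p                          ≡⟨ cong (_∙ g p) (sum-remove f) ⟩
    (f p ∙ sum (removeAt f p)) ∙ g p
      ≡⟨ cong (λ s → (f p ∙ s) ∙ g p) (sum-cong-≗ (λ i → f≗g _ (Finₚ.punchInᵢ≢i p i))) ⟩
    (f p ∙ sum (removeAt g p)) ∙ g p
      ≡⟨ solve 3 (λ a s b → (a ⊕ s) ⊕ b ⊜ (b ⊕ s) ⊕ a) refl (f p) (sum (removeAt g p)) (g p) ⟩
    (g p ∙ sum (removeAt g p)) ∙ f p     ≡⟨ cong (_∙ f p) (sym (sum-remove g)) ⟩
    sum g ∙ f p                          ∎
    where open ≡-Reasoning

module Σℕ = SumProperties ℕₚ.+-0-isCommutativeMonoid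

infixl 6 _⊕_
infixr 7 _·_

_⊕_ : Subset n → Subset n → Subset n
_⊕_ = zipWith _xor_

⊕-assoc : (x y z : Subset n) → (x ⊕ y) ⊕ z ≡ x ⊕ (y ⊕ z)
⊕-assoc = Vecₚ.zipWith-assoc Boolₚ.xor-assoc

⊕-comm : (x y : Subset n) → x ⊕ y ≡ y ⊕ x
⊕-comm = Vecₚ.zipWith-comm Boolₚ.xor-comm

⊕-identityˡ : (x : Subset n) → ∅ ⊕ x ≡ x
⊕-identityˡ = Vecₚ.zipWith-identityˡ Boolₚ.xor-identityˡ

⊕-identityʳ : (x : Subset n) → x ⊕ ∅ ≡ x
⊕-identityʳ = Vecₚ.zipWith-identityʳ Boolₚ.xor-identityʳ

⊕-self : (x : Subset n) → x ⊕ x ≡ ∅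
⊕-self []      = refl
⊕-self (a ∷ x) = cong₂ _∷_ (Boolₚ.xor-same a) (⊕-self x)

⊕-isCommutativeMonoid : IsCommutativeMonoid _≡_ (_⊕_ {n}) ∅
⊕-isCommutativeMonoid = record
  { isMonoid = record
    { isSemigroup = record { isMagma = ≡-Algebra.isMagma _⊕_ ; assoc = ⊕-assoc }
    ; identity    = ⊕-identityˡ , ⊕-identityʳ
    }
  ; comm = ⊕-comm
  }

⊕-commutativeMonoid : ℕ → CommutativeMonoid 0ℓ 0ℓ
⊕-commutativeMonoid n = record { isCommutativeMonoid = ⊕-isCommutativeMonoid {n} }

module ΣV {n} = SumProperties (⊕-isCommutativeMonoid {n})

⊕-cancelʳ : (x y : Subset n) → (x ⊕ y) ⊕ y ≡ x
⊕-cancelʳ x y = trans (⊕-assoc x y y) (trans (cong (x ⊕_) (⊕-self y)) (⊕-identityʳ x))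

⊕-cancelˡ : (x y : Subset n) → x ⊕ (x ⊕ y) ≡ y
⊕-cancelˡ x y = trans (sym (⊕-assoc x x y)) (trans (cong (_⊕ y) (⊕-self x)) (⊕-identityˡ y))

⊕≡∅⇒≡ : {x y : Subset n} → x ⊕ y ≡ ∅ → x ≡ y
⊕≡∅⇒≡ {x = x} {y} x⊕y≡∅ = begin
  x              ≡⟨ sym (⊕-cancelʳ x y) ⟩
  (x ⊕ y) ⊕ y    ≡⟨ cong (_⊕ y) x⊕y≡∅ ⟩
  ∅ ⊕ y          ≡⟨ ⊕-identityˡ y ⟩
  y              ∎
  where open ≡-Reasoning

lookup-∅ : (j : Fin n) → lookup ∅ j ≡ false
lookup-∅ j = Vecₚ.lookup-replicate j false

∅∌ : (j : Fin n) → lookup ∅ j ≢ true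
∅∌ j ∅∋j = contradiction (trans (sym (lookup-∅ j)) ∅∋j) λ ()

∧≡true : ∀ a b → a ∧ b ≡ true → a ≡ true × b ≡ true
∧≡true true true _ = refl , refl

_·_ : Bool → Subset n → Subset n
a · x = if a then x else ∅

·-distrib-xor : ∀ a b (x : Subset n) → (a xor b) · x ≡ a · x ⊕ b · x
·-distrib-xor false b     x = sym (⊕-identityˡ _)
·-distrib-xor true  false x = sym (⊕-identityʳ x)
·-distrib-xor true  true  x = sym (⊕-self x)

lookup-· : ∀ a (x : Subset n) j → lookup (a · x) j ≡ a ∧ lookup x j
lookup-· false x j = lookup-∅ j
lookup-· true  x j = refl

∈-· : ∀ a (x : Subset n) {j} → lookup (a · x) j ≡ true → a ≡ true × lookup x j ≡ true
∈-· a x {j} j∈ = ∧≡true a (lookup x j) (trans (sym (lookup-· a x j)) j∈)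

lookup-⊕ : (x y : Subset n) (j : Fin n) → lookup (x ⊕ y) j ≡ lookup x j xor lookup y j
lookup-⊕ x y j = Vecₚ.lookup-zipWith _xor_ j x y

lookup-⁅⁆ : (p : Fin n) → lookup ⁅ p ⁆ p ≡ true
lookup-⁅⁆ p = Vecₚ.[]=⇒lookup (Subsetₚ.x∈⁅x⁆ p)

lookup-⁅⁆⇒≡ : {i p : Fin n} → lookup ⁅ p ⁆ i ≡ true → i ≡ p
lookup-⁅⁆⇒≡ {i = i} {p} i∈⁅p⁆ = Subsetₚ.x∈⁅y⁆⇒x≡y p (Vecₚ.lookup⇒[]= i ⁅ p ⁆ i∈⁅p⁆)

lookup-⁅⁆-≢ : {i p : Fin n} → i ≢ p → lookup ⁅ p ⁆ i ≡ false
lookup-⁅⁆-≢ i≢p = Boolₚ.¬-not (i≢p ∘ lookup-⁅⁆⇒≡)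

≢∅⇒nonempty : {x : Subset n} → x ≢ ∅ → ∃[ j ] lookup x j ≡ true
≢∅⇒nonempty {x = []}        x≢∅ = contradiction refl x≢∅
≢∅⇒nonempty {x = true ∷ x}  x≢∅ = zero , refl
≢∅⇒nonempty {x = false ∷ x} x≢∅ with ≢∅⇒nonempty (x≢∅ ∘ cong (false ∷_))
... | j , x∋j = suc j , x∋j

lookup-false⇒≡∅ : {s : Subset n} → (∀ i → lookup s i ≡ false) → s ≡ ∅
lookup-false⇒≡∅ {s = []}    _       = refl
lookup-false⇒≡∅ {s = a ∷ s} s≗false = cong₂ _∷_ (s≗false zero) (lookup-false⇒≡∅ (s≗false ∘ suc))

xor≡true : ∀ a b → a xor b ≡ true → a ≡ true ⊎ b ≡ true
xor≡true true  b     _ = inj₁ refl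
xor≡true false true  _ = inj₂ refl

∈-sum : (f : Fin k → Subset n) (j : Fin n) → lookup (ΣV.sum f) j ≡ true →
        ∃[ i ] lookup (f i) j ≡ true
∈-sum {zero}  f j ∅∋j = contradiction ∅∋j (∅∌ j)
∈-sum {suc k} f j ∑∋j with xor≡true _ _ (trans (sym (lookup-⊕ (f zero) _ j)) ∑∋j)
... | inj₁ f₀∋j = zero , f₀∋j
... | inj₂ ∑∋j′ with ∈-sum (f ∘ suc) j ∑∋j′
...   | i , fᵢ∋j = suc i , fᵢ∋j

·-distrib-⊕ : ∀ a (x y : Subset n) → a · (x ⊕ y) ≡ a · x ⊕ a · y
·-distrib-⊕ false x y = sym (⊕-identityˡ ∅)
·-distrib-⊕ true  x y = refl

lincomb : (Fin k → Subset n) → Subset k → Subset n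
lincomb b s = ΣV.sum (λ i → lookup s i · b i)

lincomb-cong : {b c : Fin k → Subset n} → b ≗ c → ∀ s → lincomb b s ≡ lincomb c s
lincomb-cong b≗c s = ΣV.sum-cong-≗ (λ i → cong (lookup s i ·_) (b≗c i))

lincomb-∅ : (b : Fin k → Subset n) → lincomb b ∅ ≡ ∅
lincomb-∅ b = ΣV.sum-zero (λ i → cong (_· b i) (lookup-∅ i))

lincomb-⊕ : (b : Fin k → Subset n) (s t : Subset k) →
            lincomb b (s ⊕ t) ≡ lincomb b s ⊕ lincomb b t
lincomb-⊕ b s t = trans
  (ΣV.sum-cong-≗ (λ i → trans (cong (_· b i) (lookup-⊕ s t i)) (·-distrib-xor (lookup s i) (lookup t i) (b i))))
  (ΣV.∑-distrib-+ (λ i → lookup s i · b i) (λ i → lookup t i · b i))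

lincomb-⁅⁆ : (b : Fin k → Subset n) (p : Fin k) → lincomb b ⁅ p ⁆ ≡ b p
lincomb-⁅⁆ b p = trans
  (ΣV.sum-single p (λ i i≢p → cong (_· b i) (lookup-⁅⁆-≢ i≢p)))
  (cong (_· b p) (lookup-⁅⁆ p))

lincomb-updateAt : (b : Fin k → Subset n) (p : Fin k) (x : Subset n) (s : Subset k) →
  lincomb (updateAt b p (const x)) s ⊕ lookup s p · b p ≡ lincomb b s ⊕ lookup s p · x
lincomb-updateAt b p x s = trans
  (ΣV.sum-update p (λ i i≢p → cong (lookup s i ·_) (Vectorₚ.updateAt-minimal i p b i≢p)))
  (cong (λ y → lincomb b s ⊕ lookup s p · y) (Vectorₚ.updateAt-updates p b))

lincomb-insertAt : (b : Fin (suc k) → Subset n) (p : Fin (suc k)) (s : Subset k) →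
  lincomb b (insertAt s p true) ≡ b p ⊕ lincomb (removeAt b p) s
lincomb-insertAt b p s = trans (ΣV.sum-remove {i = p} (λ i → lookup (insertAt s p true) i · b i)) (cong₂ _⊕_
  (cong (_· b p) (Vecₚ.insertAt-lookup s p true))
  (ΣV.sum-cong-≗ (λ i → cong (_· b (punchIn p i)) (Vecₚ.insertAt-punchIn s p true i))))

∈-lincomb : (b : Fin k → Subset n) (s : Subset k) (j : Fin n) →
  lookup (lincomb b s) j ≡ true → ∃[ i ] lookup s i ≡ true × lookup (b i) j ≡ true
∈-lincomb b s j ∑∋j with ∈-sum (λ i → lookup s i · b i) j ∑∋j
... | i , ∋j = i , ∈-· (lookup s i) (b i) ∋j

Additive : {m : ℕ} → (Subset n → Subset m) → Set
Additive f = ∀ x y → f (x ⊕ y) ≡ f x ⊕ f y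

additive-∅ : {m : ℕ} {f : Subset n → Subset m} → Additive f → f ∅ ≡ ∅
additive-∅ {f = f} additive = begin
  f ∅                    ≡⟨ sym (⊕-cancelʳ (f ∅) (f ∅)) ⟩
  (f ∅ ⊕ f ∅) ⊕ f ∅      ≡⟨ cong (_⊕ f ∅) (sym (additive ∅ ∅)) ⟩
  f (∅ ⊕ ∅) ⊕ f ∅        ≡⟨ cong (λ y → f y ⊕ f ∅) (⊕-identityˡ ∅) ⟩
  f ∅ ⊕ f ∅              ≡⟨ ⊕-self (f ∅) ⟩
  ∅                      ∎
  where open ≡-Reasoning

additive-· : {m : ℕ} {f : Subset n → Subset m} → Additive f → ∀ a x → f (a · x) ≡ a · f x
additive-· additive false x = additive-∅ additive
additive-· additive true  x = refl

additive-lincomb : {m : ℕ} {f : Subset n → Subset m} → Additive f →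
  (b : Fin k → Subset n) (s : Subset k) → f (lincomb b s) ≡ lincomb (f ∘ b) s
additive-lincomb additive b []      = additive-∅ additive
additive-lincomb additive b (a ∷ s) = trans (additive _ _)
  (cong₂ _⊕_ (additive-· additive a (b zero)) (additive-lincomb additive (b ∘ suc) s))

lincomb-lincomb : {l : ℕ} (b : Fin k → Subset n) (c : Fin l → Subset k) (u : Subset l) →
  lincomb b (lincomb c u) ≡ lincomb (lincomb b ∘ c) u
lincomb-lincomb b = additive-lincomb (lincomb-⊕ b)

lookup-∩ : (x y : Subset n) (j : Fin n) → lookup (x ∩ y) j ≡ lookup x j ∧ lookup y j
lookup-∩ x y j = Vecₚ.lookup-zipWith _∧_ j x y

∈-∩ : (x y : Subset n) {j : Fin n} → lookup (x ∩ y) j ≡ true → lookup x j ≡ true × lookup y j ≡ true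
∈-∩ x y {j} j∈ = ∧≡true (lookup x j) (lookup y j) (trans (sym (lookup-∩ x y j)) j∈)

∩-additive : (z : Subset n) → Additive (_∩ z)
∩-additive z = Vecₚ.zipWith-distribʳ Boolₚ.∧-distribʳ-xor z

·-∧ : ∀ a b (x : Subset n) → (a ∧ b) · x ≡ a · b · x
·-∧ false b x = refl
·-∧ true  b x = refl

lincomb-scaled : (a : Subset k) (b : Fin k → Subset n) (s : Subset k) →
  lincomb (λ i → lookup a i · b i) s ≡ lincomb b (s ∩ a)
lincomb-scaled a b s = ΣV.sum-cong-≗ λ i →
  trans (sym (·-∧ (lookup s i) (lookup a i) (b i))) (cong (_· b i) (sym (lookup-∩ s a i)))

-- Bases and the exchange lemma

LinearlyIndependent : (Fin k → Subset n) → Set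
LinearlyIndependent b = ∀ s → lincomb b s ≡ ∅ → s ≡ ∅

Generates : (Subset n → Set) → (Fin k → Subset n) → Set
Generates W b = ∀ x → W x → ∃[ s ] lincomb b s ≡ x

record IsBasisOf (W : Subset n → Set) (b : Fin k → Subset n) : Set where
  field
    members     : ∀ i → W (b i)
    independent : LinearlyIndependent b
    generates   : Generates W b

record Pivot (b : Fin k → Subset n) (x : Subset n) : Set where
  constructor pivot
  field
    coefficients : Subset k
    index        : Fin k
    expands      : lincomb b coefficients ≡ x
    uses         : lookup coefficients index ≡ true

module _ {b : Fin k → Subset n} (independent : LinearlyIndependent b) where

  lincomb-injective : ∀ {s t} → lincomb b s ≡ lincomb b t → s ≡ t
  lincomb-injective {s} {t} eq = ⊕≡∅⇒≡ (independent (s ⊕ t) (begin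
    lincomb b (s ⊕ t)            ≡⟨ lincomb-⊕ b s t ⟩
    lincomb b s ⊕ lincomb b t    ≡⟨ cong (_⊕ lincomb b t) eq ⟩
    lincomb b t ⊕ lincomb b t    ≡⟨ ⊕-self (lincomb b t) ⟩
    ∅                            ∎))
    where open ≡-Reasoning

  lincomb≡member : ∀ s i → lincomb b s ≡ b i → s ≡ ⁅ i ⁆
  lincomb≡member s i eq = lincomb-injective (trans eq (sym (lincomb-⁅⁆ b i)))

  pivot-member : ∀ {i} (σ : Pivot b (b i)) → Pivot.index σ ≡ i
  pivot-member {i} (pivot s j s↦bᵢ j∈s) =
    lookup-⁅⁆⇒≡ (subst (λ v → lookup v j ≡ true) (lincomb≡member s i s↦bᵢ) j∈s)

  independent⇒injective : ∀ {i j} → b i ≡ b j → i ≡ j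
  independent⇒injective {i} bᵢ≡bⱼ = pivot-member (pivot ⁅ i ⁆ i (trans (lincomb-⁅⁆ b i) bᵢ≡bⱼ) (lookup-⁅⁆ i))

exchangeCoefficients : Subset k → Fin k → Subset k → Subset k
exchangeCoefficients c p s = s ⊕ lookup s p · (c ⊕ ⁅ p ⁆)

module Exchange {b : Fin k → Subset n} {x : Subset n} (π : Pivot b x) where

  open Pivot π renaming (coefficients to c; index to p; expands to c↦x; uses to p∈c)

  b′ : Fin k → Subset n
  b′ = updateAt b p (const x)

  private
    exch = exchangeCoefficients c p

  lincomb-exchanged : lincomb b′ c ≡ b p
  lincomb-exchanged = ⊕≡∅⇒≡ (begin
    lincomb b′ c ⊕ b p                  ≡⟨ cong (λ a → lincomb b′ c ⊕ a · b p) (sym p∈c) ⟩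
    lincomb b′ c ⊕ lookup c p · b p     ≡⟨ lincomb-updateAt b p x c ⟩
    lincomb b c ⊕ lookup c p · x        ≡⟨ cong₂ (λ y a → y ⊕ a · x) c↦x p∈c ⟩
    x ⊕ x                               ≡⟨ ⊕-self x ⟩
    ∅                                   ∎)
    where open ≡-Reasoning

  lincomb-exchangeCoefficients : ∀ s → lincomb b′ (exch s) ≡ lincomb b s
  lincomb-exchangeCoefficients s = begin
    lincomb b′ (s ⊕ a · (c ⊕ ⁅ p ⁆))                ≡⟨ lincomb-⊕ b′ s _ ⟩
    lincomb b′ s ⊕ lincomb b′ (a · (c ⊕ ⁅ p ⁆))     ≡⟨ cong (lincomb b′ s ⊕_) (additive-· (lincomb-⊕ b′) a (c ⊕ ⁅ p ⁆)) ⟩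
    lincomb b′ s ⊕ a · lincomb b′ (c ⊕ ⁅ p ⁆)       ≡⟨ cong (λ y → lincomb b′ s ⊕ a · y) (lincomb-⊕ b′ c ⁅ p ⁆) ⟩
    lincomb b′ s ⊕ a · (lincomb b′ c ⊕ lincomb b′ ⁅ p ⁆)
      ≡⟨ cong₂ (λ y z → lincomb b′ s ⊕ a · (y ⊕ z))
           lincomb-exchanged (trans (lincomb-⁅⁆ b′ p) (Vectorₚ.updateAt-updates p b)) ⟩
    lincomb b′ s ⊕ a · (b p ⊕ x)                    ≡⟨ cong (lincomb b′ s ⊕_) (·-distrib-⊕ a (b p) x) ⟩
    lincomb b′ s ⊕ (a · b p ⊕ a · x)                ≡⟨ sym (⊕-assoc _ _ _) ⟩
    (lincomb b′ s ⊕ a · b p) ⊕ a · x                ≡⟨ cong (_⊕ a · x) (lincomb-updateAt b p x s) ⟩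
    (lincomb b s ⊕ a · x) ⊕ a · x                   ≡⟨ ⊕-cancelʳ _ _ ⟩
    lincomb b s                                     ∎
    where
      open ≡-Reasoning
      a = lookup s p

  private
    lookup-exch : ∀ s i →
      lookup (exch s) i ≡ lookup s i xor (lookup s p ∧ (lookup c i xor lookup ⁅ p ⁆ i))
    lookup-exch s i = trans (lookup-⊕ s _ i)
      (cong (lookup s i xor_) (trans (lookup-· (lookup s p) _ i) (cong (lookup s p ∧_) (lookup-⊕ c ⁅ p ⁆ i))))

  lookup-exchangeCoefficients-p : ∀ s → lookup (exch s) p ≡ lookup s p
  lookup-exchangeCoefficients-p s = begin
    lookup (exch s) p                                  ≡⟨ lookup-exch s p ⟩
    lookup s p xor (lookup s p ∧ (lookup c p xor lookup ⁅ p ⁆ p))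
      ≡⟨ cong₂ (λ a b → lookup s p xor (lookup s p ∧ (a xor b))) p∈c (lookup-⁅⁆ p) ⟩
    lookup s p xor (lookup s p ∧ false)                ≡⟨ cong (lookup s p xor_) (Boolₚ.∧-zeroʳ (lookup s p)) ⟩
    lookup s p xor false                               ≡⟨ Boolₚ.xor-identityʳ (lookup s p) ⟩
    lookup s p                                         ∎
    where open ≡-Reasoning

  lookup-exchangeCoefficients-≢ : ∀ s {i} → i ≢ p →
    lookup (exch s) i ≡ lookup s i xor (lookup s p ∧ lookup c i)
  lookup-exchangeCoefficients-≢ s {i} i≢p = trans (lookup-exch s i)
    (cong (λ a → lookup s i xor (lookup s p ∧ a))
      (trans (cong (lookup c i xor_) (lookup-⁅⁆-≢ i≢p)) (Boolₚ.xor-identityʳ (lookup c i))))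

  exchange-generates : ∀ {W} → Generates W b → Generates W b′
  exchange-generates generates y y∈W with generates y y∈W
  ... | s , s↦y = exch s , trans (lincomb-exchangeCoefficients s) s↦y

module _ {b : Fin k → Subset n} {x : Subset n} (π : Pivot b x) where

  open Pivot π renaming (coefficients to c; index to p; expands to c↦x; uses to p∈c)
  open Exchange π

  -- Exchanging back along the same coefficients restores b (lincomb-exchanged),
  -- which turns a relation among the members of b′ into one among those of b.
  exchange-independent : LinearlyIndependent b → LinearlyIndependent b′
  exchange-independent independent s s↦∅ = begin
    s                                      ≡⟨ sym (⊕-identityʳ s) ⟩
    s ⊕ ∅                                  ≡⟨ cong (λ a → s ⊕ a · (c ⊕ ⁅ p ⁆)) (sym sₚ≡false) ⟩
    exchangeCoefficients c p s             ≡⟨ exch≡∅ ⟩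
    ∅                                      ∎
    where
      open ≡-Reasoning
      module Back = Exchange (pivot c p lincomb-exchanged p∈c)
      b″≗b : Back.b′ ≗ b
      b″≗b i with i Finₚ.≟ p
      ... | yes refl = Vectorₚ.updateAt-updates p b′
      ... | no i≢p   = trans (Vectorₚ.updateAt-minimal i p b′ i≢p) (Vectorₚ.updateAt-minimal i p b i≢p)
      exch≡∅ : exchangeCoefficients c p s ≡ ∅
      exch≡∅ = independent (exchangeCoefficients c p s) (begin
        lincomb b (exchangeCoefficients c p s)       ≡⟨ sym (lincomb-cong b″≗b (exchangeCoefficients c p s)) ⟩
        lincomb Back.b′ (exchangeCoefficients c p s) ≡⟨ Back.lincomb-exchangeCoefficients s ⟩
        lincomb b′ s                                 ≡⟨ s↦∅ ⟩
        ∅                                            ∎)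
      sₚ≡false : lookup s p ≡ false
      sₚ≡false = trans (sym (lookup-exchangeCoefficients-p s))
        (trans (cong (λ v → lookup v p) exch≡∅) (lookup-∅ p))

  exchange-isBasisOf : {W : Subset n → Set} → IsBasisOf W b → W x → IsBasisOf W b′
  exchange-isBasisOf {W} basis x∈W = record
    { members     = members′
    ; independent = exchange-independent independent
    ; generates   = exchange-generates generates
    }
    where
      open IsBasisOf basis
      members′ : ∀ i → W (b′ i)
      members′ i with i Finₚ.≟ p
      ... | yes refl = subst W (sym (Vectorₚ.updateAt-updates p b)) x∈W
      ... | no i≢p   = subst W (sym (Vectorₚ.updateAt-minimal i p b i≢p)) (members i)

independent-updateAt⇒coefficient : {b : Fin k → Subset n} {p : Fin k} {x : Subset n} {a : Subset k} →
  LinearlyIndependent (updateAt b p (const x)) → lincomb b a ≡ x → lookup a p ≡ true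
independent-updateAt⇒coefficient {b = b} {p} {x} {a} independent a↦x with lookup a p in aₚ≡
... | true  = refl
... | false = trans (sym aₚ≡) (trans (cong (λ v → lookup v p) (lincomb≡member independent a p (begin
  lincomb b′ a                   ≡⟨ sym (⊕-identityʳ _) ⟩
  lincomb b′ a ⊕ false · b p     ≡⟨ cong (λ c → lincomb b′ a ⊕ c · b p) (sym aₚ≡) ⟩
  lincomb b′ a ⊕ lookup a p · b p ≡⟨ lincomb-updateAt b p x a ⟩
  lincomb b a ⊕ lookup a p · x   ≡⟨ cong (λ c → lincomb b a ⊕ c · x) aₚ≡ ⟩
  lincomb b a ⊕ ∅                ≡⟨ ⊕-identityʳ _ ⟩
  lincomb b a                    ≡⟨ a↦x ⟩
  x                              ≡⟨ sym (Vectorₚ.updateAt-updates p b) ⟩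
  b′ p                           ∎))) (lookup-⁅⁆ p))
  where
    open ≡-Reasoning
    b′ = updateAt b p (const x)

isBasisOf-cong : {W : Subset n → Set} {b c : Fin k → Subset n} → b ≗ c → IsBasisOf W b → IsBasisOf W c
isBasisOf-cong {W = W} b≗c basis = record
  { members     = λ i → subst W (b≗c i) (members i)
  ; independent = λ s c↦∅ → independent s (trans (lincomb-cong b≗c s) c↦∅)
  ; generates   = λ x x∈W → let s , s↦x = generates x x∈W in s , trans (sym (lincomb-cong b≗c s)) s↦x
  }
  where open IsBasisOf basis

InExpansionᶠ : (Fin k → Subset n) → Subset n → Subset n → Set
InExpansionᶠ b x y = Σ[ π ∈ Pivot b x ] b (Pivot.index π) ≡ y

inExpansionᶠ-cong : {b c : Fin k → Subset n} {x y : Subset n} → b ≗ c → InExpansionᶠ b x y → InExpansionᶠ c x y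
inExpansionᶠ-cong b≗c (pivot s i s↦x i∈s , bᵢ≡y) =
  pivot s i (trans (sym (lincomb-cong b≗c s)) s↦x) i∈s , trans (sym (b≗c i)) bᵢ≡y

weightᶠ : (Fin k → Subset n) → ℕ
weightᶠ b = Σℕ.sum (λ i → ∣ b i ∣)

weightᶠ-updateAt : (b : Fin k → Subset n) (p : Fin k) (x : Subset n) →
  weightᶠ (updateAt b p (const x)) + ∣ b p ∣ ≡ weightᶠ b + ∣ x ∣
weightᶠ-updateAt b p x = trans
  (Σℕ.sum-update p (λ i i≢p → cong ∣_∣ (Vectorₚ.updateAt-minimal i p b i≢p)))
  (cong (λ y → weightᶠ b + ∣ y ∣) (Vectorₚ.updateAt-updates p b))

weightClass : (Fin k → Subset n) → ℕ → Subset k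
weightClass b w = tabulate (λ j → ∣ b j ∣ ≡ᵇ w)

∈-weightClass : (b : Fin k → Subset n) (w : ℕ) (j : Fin k) → lookup (weightClass b w) j ≡ true ⇔ ∣ b j ∣ ≡ w
∈-weightClass b w j = mk⇔
  (λ j∈ → ℕₚ.≡ᵇ⇒≡ ∣ b j ∣ w (Equivalence.from Boolₚ.T-≡ (trans (sym (Vecₚ.lookup∘tabulate _ j)) j∈)))
  (λ ∣bⱼ∣≡w → trans (Vecₚ.lookup∘tabulate _ j) (Equivalence.to Boolₚ.T-≡ (ℕₚ.≡⇒≡ᵇ ∣ b j ∣ w ∣bⱼ∣≡w)))

-- Connectivity through supports

module SupportConnectivity {a ℓ} (S : Setoid a ℓ) {q : ℕ} (P : Fin q → Setoid.Carrier S) where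

  open Setoid S using (_≈_) renaming (Carrier to A; sym to ≈-sym; trans to ≈-trans)
  open CommutativeMonoidSolver (⊕-commutativeMonoid q) using (solve; _⊜_) renaming (_⊕_ to _⊕′_)

  -- d keeps touching its support while absorbing items whose support meets it; irreducibility
  -- keeps that support nonempty, and the balance equation makes it meet the support of t.
  Touches : A → Subset q → Set ℓ
  Touches x hx = ∀ j → lookup hx j ≡ true → x ≈ P j

  mutual
    connect : (h : Fin n → Subset q) (r : Fin n → A) → (∀ i → Touches (r i) (h i)) →
      ∀ {d t} hd ht → Touches d hd → Touches t ht →
      hd ⊕ ht ≡ ΣV.sum h → (∀ s → hd ⊕ lincomb h s ≢ ∅) → d ≈ t
    connect h r h-touch hd ht d-touch t-touch balance irreducible
      with ≢∅⇒nonempty (λ hd≡∅ →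
             irreducible ∅ (trans (cong (hd ⊕_) (lincomb-∅ h)) (trans (⊕-identityʳ hd) hd≡∅)))
    ... | j₀ , hd∋j₀ with lookup ht j₀ in ht∌j₀
    ...   | true  = ≈-trans (d-touch j₀ hd∋j₀) (≈-sym (t-touch j₀ ht∌j₀))
    ...   | false = absorb h r h-touch hd ht d-touch t-touch balance irreducible j₀ hd∋j₀ (begin
      lookup (ΣV.sum h) j₀           ≡⟨ cong (λ v → lookup v j₀) (sym balance) ⟩
      lookup (hd ⊕ ht) j₀            ≡⟨ lookup-⊕ hd ht j₀ ⟩
      lookup hd j₀ xor lookup ht j₀  ≡⟨ cong₂ _xor_ hd∋j₀ ht∌j₀ ⟩
      true                           ∎)
      where open ≡-Reasoning

    absorb : (h : Fin n → Subset q) (r : Fin n → A) → (∀ i → Touches (r i) (h i)) →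
      ∀ {d t} hd ht → Touches d hd → Touches t ht →
      hd ⊕ ht ≡ ΣV.sum h → (∀ s → hd ⊕ lincomb h s ≢ ∅) →
      ∀ j₀ → lookup hd j₀ ≡ true → lookup (ΣV.sum h) j₀ ≡ true → d ≈ t
    absorb {zero} h r h-touch hd ht d-touch t-touch balance irreducible j₀ hd∋j₀ ∑∋j₀ =
      contradiction ∑∋j₀ (∅∌ j₀)
    absorb {suc n} h r h-touch {d} hd ht d-touch t-touch balance irreducible j₀ hd∋j₀ ∑∋j₀ =
      connect (removeAt h i₀) (removeAt r i₀) (h-touch ∘ punchIn i₀)
        (hd ⊕ h i₀) ht d-touch′ t-touch balance′ irreducible′
      where
        open ≡-Reasoning
        i₀ = proj₁ (∈-sum h j₀ ∑∋j₀)
        hᵢ₀∋j₀ = proj₂ (∈-sum h j₀ ∑∋j₀)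
        d-touch′ : Touches d (hd ⊕ h i₀)
        d-touch′ j ∋j with xor≡true _ _ (trans (sym (lookup-⊕ hd (h i₀) j)) ∋j)
        ... | inj₁ hd∋j  = d-touch j hd∋j
        ... | inj₂ hᵢ₀∋j =
          ≈-trans (d-touch j₀ hd∋j₀) (≈-trans (≈-sym (h-touch i₀ j₀ hᵢ₀∋j₀)) (h-touch i₀ j hᵢ₀∋j))
        balance′ : hd ⊕ h i₀ ⊕ ht ≡ ΣV.sum (removeAt h i₀)
        balance′ = begin
          hd ⊕ h i₀ ⊕ ht
            ≡⟨ solve 3 (λ x y z → (x ⊕′ y) ⊕′ z ⊜ y ⊕′ (x ⊕′ z)) refl hd (h i₀) ht ⟩
          h i₀ ⊕ (hd ⊕ ht)                        ≡⟨ cong (h i₀ ⊕_) (trans balance (ΣV.sum-remove {i = i₀} h)) ⟩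
          h i₀ ⊕ (h i₀ ⊕ ΣV.sum (removeAt h i₀))  ≡⟨ ⊕-cancelˡ (h i₀) _ ⟩
          ΣV.sum (removeAt h i₀)                  ∎
        irreducible′ : ∀ s → hd ⊕ h i₀ ⊕ lincomb (removeAt h i₀) s ≢ ∅
        irreducible′ s = irreducible (insertAt s i₀ true) ∘ trans (begin
          hd ⊕ lincomb h (insertAt s i₀ true)      ≡⟨ cong (hd ⊕_) (lincomb-insertAt h i₀ s) ⟩
          hd ⊕ (h i₀ ⊕ lincomb (removeAt h i₀) s)  ≡⟨ sym (⊕-assoc _ _ _) ⟩
          hd ⊕ h i₀ ⊕ lincomb (removeAt h i₀) s    ∎)

  connect-at : (h : Fin n → Subset q) (r : Fin n → A) → (∀ i → Touches (r i) (h i)) →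
    (p : Fin n) → ∀ {t} ht → Touches t ht → ht ≡ ΣV.sum h →
    (∀ s → lookup s p ≡ true → lincomb h s ≢ ∅) → r p ≈ t
  connect-at {suc n} h r h-touch p ht t-touch ht≡∑ irreducible =
    connect (removeAt h p) (removeAt r p) (h-touch ∘ punchIn p) (h p) ht (h-touch p) t-touch balance irreducible′
    where
      balance : h p ⊕ ht ≡ ΣV.sum (removeAt h p)
      balance = trans (cong (h p ⊕_) (trans ht≡∑ (ΣV.sum-remove {i = p} h))) (⊕-cancelˡ (h p) _)
      irreducible′ : ∀ s → h p ⊕ lincomb (removeAt h p) s ≢ ∅
      irreducible′ s = irreducible (insertAt s p true) (Vecₚ.insertAt-lookup s p true) ∘ trans (lincomb-insertAt h p s)

module _ {A : Set} where

  -- length (L [ p ]∷= x) is only propositionally length L, hence the cast.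
  record _Represents_ (L : List A) (b : Fin k → A) : Set where
    constructor represents
    field
      length≡ : length L ≡ k
      lookup≡ : ∀ j → List.lookup L j ≡ b (cast length≡ j)

  lookup-∷= : (L : List A) (p : Fin (length L)) (x : A) (j : Fin (length (L [ p ]∷= x))) →
    List.lookup (L [ p ]∷= x) j ≡ updateAt (List.lookup L) p (const x) (cast (Listₚ.length-∷= L p x) j)
  lookup-∷= (y ∷ L) zero    x zero    = refl
  lookup-∷= (y ∷ L) zero    x (suc j) = cong (List.lookup L) (sym (Finₚ.cast-is-id refl j))
  lookup-∷= (y ∷ L) (suc p) x zero    = refl
  lookup-∷= (y ∷ L) (suc p) x (suc j) = lookup-∷= L p x j

  represents-∷= : (L : List A) (p : Fin (length L)) (x : A) →
    (L [ p ]∷= x) Represents updateAt (List.lookup L) p (const x)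
  represents-∷= L p x = represents (Listₚ.length-∷= L p x) (lookup-∷= L p x)

  represents-cong : (P : ∀ {k} → (Fin k → A) → Set) →
    (∀ {k} {b c : Fin k → A} → b ≗ c → P b → P c) →
    ∀ {L} {b : Fin k → A} → L Represents b → P (List.lookup L) ⇔ P b
  represents-cong P P-cong {L} {b} (represents refl L≗b) = mk⇔ (P-cong lookup≗b) (P-cong (sym ∘ lookup≗b))
    where
      lookup≗b : List.lookup L ≗ b
      lookup≗b j = trans (L≗b j) (cong b (Finₚ.cast-is-id refl j))

  ∈⇔lookup : ∀ {L : List A} {x : A} → x ∈ L ⇔ (∃[ i ] List.lookup L i ≡ x)
  ∈⇔lookup = mk⇔ (λ x∈L → Any.index x∈L , sym (Anyₚ.lookup-index x∈L))
                 (λ { (i , refl) → ∈ₚ.∈-lookup i })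

  represents-∈ : ∀ {L} {b : Fin k → A} {x} → L Represents b → x ∈ L ⇔ (∃[ i ] b i ≡ x)
  represents-∈ {L = L} {x = x} L≈b = ⇔.trans (∈⇔lookup {L = L})
    (represents-cong (λ b → ∃[ i ] b i ≡ x) (λ b≗c (i , bᵢ≡x) → i , trans (sym (b≗c i)) bᵢ≡x) L≈b)

  ∷=-split : (L : List A) (p : Fin (length L)) (x : A) →
    ∃[ xs ] ∃[ ys ] L ≡ xs ++ List.lookup L p ∷ ys × L [ p ]∷= x ≡ xs ++ x ∷ ys
  ∷=-split (y ∷ L) zero    x = [] , L , refl , refl
  ∷=-split (y ∷ L) (suc p) x with ∷=-split L p x
  ... | xs , ys , L≡ , L′≡ = y ∷ xs , ys , cong (y ∷_) L≡ , cong (y ∷_) L′≡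

  ++-∷= : (xs ys : List A) (y x : A) →
    ∃[ p ] List.lookup (xs ++ y ∷ ys) p ≡ y × (xs ++ y ∷ ys) [ p ]∷= x ≡ xs ++ x ∷ ys
  ++-∷= []       ys y x = zero , refl , refl
  ++-∷= (z ∷ xs) ys y x with ++-∷= xs ys y x
  ... | p , bₚ≡y , L′≡ = suc p , bₚ≡y , cong (z ∷_) L′≡

-- Minimum cycle bases

module CycleBases (G : Graph) where

  sumSel≡lincomb : (L : List (EdgeSet G)) (s : Fin (length L) → Bool) →
    sumSel G L s ≡ lincomb (List.lookup L) (tabulate s)
  sumSel≡lincomb []      s = refl
  sumSel≡lincomb (x ∷ L) s = cong (s zero · x ⊕_) (sumSel≡lincomb L (s ∘ suc))

  sumSel-lookup : (L : List (EdgeSet G)) (s : Subset (length L)) →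
    sumSel G L (lookup s) ≡ lincomb (List.lookup L) s
  sumSel-lookup L s = trans (sumSel≡lincomb L (lookup s)) (cong (lincomb _) (Vecₚ.tabulate∘lookup s))

  weight≡weightᶠ : (L : List (EdgeSet G)) → weight G L ≡ weightᶠ (List.lookup L)
  weight≡weightᶠ []      = refl
  weight≡weightᶠ (x ∷ L) = cong (∣ x ∣ +_) (weight≡weightᶠ L)

  isCycleBasis⇔isBasisOf : ∀ {L} → IsCycleBasis G L ⇔ IsBasisOf (IsCycle G) (List.lookup L)
  isCycleBasis⇔isBasisOf {L} = mk⇔ to from
    where
      to : IsCycleBasis G L → IsBasisOf (IsCycle G) (List.lookup L)
      to (cycles , independent , spans) = record
        { members     = λ i → All.lookup cycles (∈ₚ.∈-lookup i)
        ; independent = λ s s↦∅ → lookup-false⇒≡∅ (independent (lookup s) (trans (sumSel-lookup L s) s↦∅))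
        ; generates   = λ x x∈Z → let s , s↦x = spans x x∈Z in tabulate s , trans (sym (sumSel≡lincomb L s)) s↦x
        }
      from : IsBasisOf (IsCycle G) (List.lookup L) → IsCycleBasis G L
      from basis = cycles , independent′ , spans
        where
          open IsBasisOf basis
          cycles : All.All (IsCycle G) L
          cycles = All.tabulate λ x∈L →
            let i , bᵢ≡x = Equivalence.to (∈⇔lookup {L = L}) x∈L in subst (IsCycle G) bᵢ≡x (members i)
          independent′ : Independent G L
          independent′ s s↦∅ i = begin
            s i                     ≡⟨ sym (Vecₚ.lookup∘tabulate s i) ⟩
            lookup (tabulate s) i
              ≡⟨ cong (λ v → lookup v i) (independent (tabulate s) (trans (sym (sumSel≡lincomb L s)) s↦∅)) ⟩
            lookup ∅ i              ≡⟨ lookup-∅ i ⟩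
            false                   ∎
            where open ≡-Reasoning
          spans : Spans G L
          spans x x∈Z = let s , s↦x = generates x x∈Z in lookup s , trans (sumSel-lookup L s) s↦x

  InExpansion-∷ : ∀ {x L C D} a → InExpansion G L C D → InExpansion G (x ∷ L) (a · x ⊕ C) D
  InExpansion-∷ a (s , s↦C , i , bᵢ≡D , i∈s) =
    (λ { zero → a ; (suc j) → s j }) , cong (a · _ ⊕_) s↦C , suc i , bᵢ≡D , i∈s

  lookup⇒InExpansion : ∀ {D} L (s : Fin (length L) → Bool) i →
    List.lookup L i ≡ D → s i ≡ true → InExpansion G L (sumSel G L s) D
  lookup⇒InExpansion (x ∷ L) s zero    x≡D i∈s = s , refl , zero , x≡D , i∈s
  lookup⇒InExpansion (x ∷ L) s (suc i) bᵢ≡D i∈s = InExpansion-∷ (s zero) (lookup⇒InExpansion L (s ∘ suc) i bᵢ≡D i∈s)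

  InExpansion⇒lookup : ∀ {C D} L → ((s , _ , i , _) : InExpansion G L C D) → List.lookup L i ≡ D
  InExpansion⇒lookup (x ∷ L) (s , _ , zero  , x≡D , _)  = x≡D
  InExpansion⇒lookup (x ∷ L) (s , _ , suc i , bᵢ≡D , i∈s) = InExpansion⇒lookup L (s ∘ suc , refl , i , bᵢ≡D , i∈s)

  InExpansion⇔InExpansionᶠ : ∀ {L C D} → InExpansion G L C D ⇔ InExpansionᶠ (List.lookup L) C D
  InExpansion⇔InExpansionᶠ {L} {C} {D} = mk⇔
    (λ e@(s , s↦C , i , _ , i∈s) → pivot (tabulate s) i (trans (sym (sumSel≡lincomb L s)) s↦C)
       (trans (Vecₚ.lookup∘tabulate s i) i∈s) , InExpansion⇒lookup L e)
    (λ (pivot s i s↦C i∈s , bᵢ≡D) → subst (λ x → InExpansion G L x D) (trans (sumSel-lookup L s) s↦C)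
       (lookup⇒InExpansion L (lookup s) i bᵢ≡D i∈s))

  module _ {L : List (EdgeSet G)} {b : Fin k → EdgeSet G} (L≈b : L Represents b) where

    represents-isCycleBasis : IsCycleBasis G L ⇔ IsBasisOf (IsCycle G) b
    represents-isCycleBasis = ⇔.trans (isCycleBasis⇔isBasisOf {L = L})
      (represents-cong (IsBasisOf (IsCycle G)) isBasisOf-cong L≈b)

    represents-weight : weight G L ≡ weightᶠ b
    represents-weight = trans (weight≡weightᶠ L) (Equivalence.to
      (represents-cong (λ c → weightᶠ (List.lookup L) ≡ weightᶠ c)
        (λ b≗c eq → trans eq (Σℕ.sum-cong-≗ (cong ∣_∣ ∘ b≗c))) L≈b) refl)

    represents-InExpansion : ∀ {C D} → InExpansion G L C D ⇔ InExpansionᶠ b C D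
    represents-InExpansion = ⇔.trans (InExpansion⇔InExpansionᶠ {L = L})
      (represents-cong (λ c → InExpansionᶠ c _ _) inExpansionᶠ-cong L≈b)

  weight-∷= : (B : List (EdgeSet G)) (p : Fin (length B)) (x : EdgeSet G) →
    weight G (B [ p ]∷= x) + ∣ List.lookup B p ∣ ≡ weight G B + ∣ x ∣
  weight-∷= B p x = begin
    weight G (B [ p ]∷= x) + ∣ List.lookup B p ∣          ≡⟨ cong (_+ _) (represents-weight (represents-∷= B p x)) ⟩
    weightᶠ (updateAt b p (const x)) + ∣ b p ∣            ≡⟨ weightᶠ-updateAt b p x ⟩
    weightᶠ b + ∣ x ∣                                    ≡⟨ cong (_+ ∣ x ∣) (sym (weight≡weightᶠ B)) ⟩
    weight G B + ∣ x ∣                                   ∎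
    where
      open ≡-Reasoning
      b = List.lookup B

  mcb-isBasisOf : ∀ {B} → IsMCB G B → IsBasisOf (IsCycle G) (List.lookup B)
  mcb-isBasisOf = Equivalence.to isCycleBasis⇔isBasisOf ∘ proj₁

  module _ {B : List (EdgeSet G)} {x : EdgeSet G} (x∈Z : IsCycle G x) (π : Pivot (List.lookup B) x) where

    open Pivot π using () renaming (index to p)

    exchange-isCycleBasis : IsCycleBasis G B → IsCycleBasis G (B [ p ]∷= x)
    exchange-isCycleBasis basis = Equivalence.from (represents-isCycleBasis (represents-∷= B p x))
      (exchange-isBasisOf π (Equivalence.to isCycleBasis⇔isBasisOf basis) x∈Z)

    mcb-expansion-≤ : IsMCB G B → ∣ List.lookup B p ∣ ≤ ∣ x ∣
    mcb-expansion-≤ (basis , minimal) = ℕₚ.+-cancelˡ-≤ (weight G B) _ _ (begin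
      weight G B + ∣ List.lookup B p ∣             ≤⟨ ℕₚ.+-monoˡ-≤ _ (minimal _ (exchange-isCycleBasis basis)) ⟩
      weight G (B [ p ]∷= x) + ∣ List.lookup B p ∣ ≡⟨ weight-∷= B p x ⟩
      weight G B + ∣ x ∣                          ∎)
      where open ℕₚ.≤-Reasoning

    mcb-exchange : IsMCB G B → ∣ x ∣ ≡ ∣ List.lookup B p ∣ → IsMCB G (B [ p ]∷= x)
    mcb-exchange (basis , minimal) ∣x∣≡ = exchange-isCycleBasis basis ,
      λ B′ basis′ → subst (_≤ weight G B′) (sym same-weight) (minimal B′ basis′)
      where
        same-weight : weight G (B [ p ]∷= x) ≡ weight G B
        same-weight = ℕₚ.+-cancelʳ-≡ _ _ _ (trans (weight-∷= B p x) (cong (weight G B +_) ∣x∣≡))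

  mcb-exchange-length : ∀ {B p x} → IsMCB G B → IsMCB G (B [ p ]∷= x) → ∣ x ∣ ≡ ∣ List.lookup B p ∣
  mcb-exchange-length {B} {p} {x} (basis , minimal) (basis′ , minimal′) = sym (ℕₚ.+-cancelˡ-≡ (weight G B) _ _ (begin
    weight G B + ∣ List.lookup B p ∣             ≡⟨ cong (_+ _) (ℕₚ.≤-antisym (minimal _ basis′) (minimal′ _ basis)) ⟩
    weight G (B [ p ]∷= x) + ∣ List.lookup B p ∣ ≡⟨ weight-∷= B p x ⟩
    weight G B + ∣ x ∣                          ∎))
    where open ≡-Reasoning

  mcb-exchange-coefficient : ∀ {B p x} → IsCycleBasis G (B [ p ]∷= x) →
    ∀ a → lincomb (List.lookup B) a ≡ x → lookup a p ≡ true
  mcb-exchange-coefficient {B} {p} {x} basis′ a = independent-updateAt⇒coefficient {a = a}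
    (IsBasisOf.independent (Equivalence.to (represents-isCycleBasis (represents-∷= B p x)) basis′))

  ∷=⇒∼pi : ∀ {B p x} → IsMCB G B → IsMCB G (B [ p ]∷= x) → _∼pi_ G x (List.lookup B p)
  ∷=⇒∼pi {B} {p} {x} mcb mcb′ with ∷=-split B p x
  ... | xs , ys , B≡ , B′≡ = xs , ys , subst (IsMCB G) B≡ mcb , subst (IsMCB G) B′≡ mcb′

  ∼pi⇒∷= : ∀ {x y} → _∼pi_ G x y →
    ∃[ B ] ∃[ p ] IsMCB G B × List.lookup B p ≡ y × IsMCB G (B [ p ]∷= x)
  ∼pi⇒∷= {x} {y} (xs , ys , mcb , mcb′) with ++-∷= xs ys y x
  ... | p , bₚ≡y , B′≡ = xs ++ y ∷ ys , p , mcb , bₚ≡y , subst (IsMCB G) (sym B′≡) mcb′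

  ∼pi-refl : ∀ {x} → Relevant G x → _∼pi_ G x x
  ∼pi-refl (B , mcb , x∈B) with ∈ₚ.∈-∃++ x∈B
  ... | xs , ys , refl = xs , ys , mcb , mcb

  ∼pi-sym : ∀ {x y} → _∼pi_ G x y → _∼pi_ G y x
  ∼pi-sym (xs , ys , mcb , mcb′) = xs , ys , mcb′ , mcb

  relevant⇒cycle : ∀ {x} → Relevant G x → IsCycle G x
  relevant⇒cycle (B , ((cycles , _) , _) , x∈B) = All.lookup cycles x∈B

  module _ {B : List (EdgeSet G)} {x y : EdgeSet G} (g : Gen G B x y) where

    gen-relevant : Relevant G x
    gen-relevant = proj₁ g

    gen-∉ : ¬ x ∈ B
    gen-∉ = proj₁ (proj₂ g)

    gen-∈ : y ∈ B
    gen-∈ = proj₁ (proj₂ (proj₂ g))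

    gen-expansion : InExpansionᶠ (List.lookup B) x y
    gen-expansion = Equivalence.to (InExpansion⇔InExpansionᶠ {L = B}) (proj₁ (proj₂ (proj₂ (proj₂ g))))

    gen-length : ∣ x ∣ ≡ ∣ y ∣
    gen-length = proj₂ (proj₂ (proj₂ (proj₂ g)))

  mkGen : ∀ {B x y} → Relevant G x → ¬ x ∈ B → y ∈ B → InExpansionᶠ (List.lookup B) x y → ∣ x ∣ ≡ ∣ y ∣ →
    Gen G B x y
  mkGen {B} x-relevant x∉B y∈B x↝y ∣x∣≡∣y∣ =
    x-relevant , x∉B , y∈B , Equivalence.from (InExpansion⇔InExpansionᶠ {L = B}) x↝y , ∣x∣≡∣y∣

  gen⇒∼pi : ∀ {B x y} → IsMCB G B → Gen G B x y → _∼pi_ G x y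
  gen⇒∼pi {x = x} mcb g = subst (_∼pi_ G x) bₚ≡y
    (∷=⇒∼pi mcb (mcb-exchange (relevant⇒cycle (gen-relevant g)) π mcb (trans (gen-length g) (cong ∣_∣ (sym bₚ≡y)))))
    where
      π = proj₁ (gen-expansion g)
      bₚ≡y = proj₂ (gen-expansion g)

  -- From ∼pi to the generated closure

  _≟ᵉ_ : DecidableEquality (EdgeSet G)
  _≟ᵉ_ = Vecₚ.≡-dec Boolₚ._≟_

  open import Data.List.Membership.DecPropositional _≟ᵉ_ using (_∈?_)

  module _ {M : List (EdgeSet G)} (mcbM : IsMCB G M) where

    private
      bM = List.lookup M
      module M = IsBasisOf (mcb-isBasisOf mcbM)

    expansion⇒closure : ∀ {x} → Relevant G x → (π : Pivot bM x) →
      ∣ x ∣ ≡ ∣ bM (Pivot.index π) ∣ → GenClosure G M x (bM (Pivot.index π))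
    expansion⇒closure {x} x-relevant π@(pivot s j s↦x j∈s) ∣x∣≡ with x ∈? M
    ... | yes x∈M = subst (GenClosure G M x) (trans (sym bᵢ≡x) (cong bM (sym j≡i))) ε
      where
        i = proj₁ (Equivalence.to (∈⇔lookup {L = M}) x∈M)
        bᵢ≡x = proj₂ (Equivalence.to (∈⇔lookup {L = M}) x∈M)
        j≡i = pivot-member M.independent (pivot s j (trans s↦x (sym bᵢ≡x)) j∈s)
    ... | no x∉M = fwd (mkGen x-relevant x∉M (∈ₚ.∈-lookup j) (π , refl) ∣x∣≡) ◅ ε

    module _ {N : List (EdgeSet G)} {p : Fin (length N)} {x : EdgeSet G}
      (mcbN : IsMCB G N) (mcbN′ : IsMCB G (N [ p ]∷= x)) (x-relevant : Relevant G x) where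

      private
        bN = List.lookup N
        module N = IsBasisOf (mcb-isBasisOf mcbN)
        w = ∣ x ∣
        x∈Z = relevant⇒cycle x-relevant
        a = proj₁ (N.generates x x∈Z)
        a↦x = proj₂ (N.generates x x∈Z)
        γ : Fin (length N) → Subset (length M)
        γ i = proj₁ (M.generates (bN i) (N.members i))
        γ↦ : ∀ i → lincomb bM (γ i) ≡ bN i
        γ↦ i = proj₂ (M.generates (bN i) (N.members i))
        heavy = weightClass bM w
        h : Fin (length N) → Subset (length M)
        h i = γ i ∩ heavy
        items : Fin (length N) → Subset (length M)
        items i = lookup a i · h i

        ∣bₚ∣≡w : ∣ bN p ∣ ≡ w
        ∣bₚ∣≡w = sym (mcb-exchange-length mcbN mcbN′)

        N-expansion-≤ : ∀ {i} → lookup a i ≡ true → ∣ bN i ∣ ≤ w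
        N-expansion-≤ {i} i∈a = mcb-expansion-≤ x∈Z (pivot a i a↦x i∈a) mcbN

        M-expansion-≤ : ∀ {i j} → lookup (γ i) j ≡ true → ∣ bM j ∣ ≤ ∣ bN i ∣
        M-expansion-≤ {i} {j} j∈γᵢ = mcb-expansion-≤ (N.members i) (pivot (γ i) j (γ↦ i) j∈γᵢ) mcbM

        lincomb-γ : ∀ t → lincomb bM (lincomb γ t) ≡ lincomb bN t
        lincomb-γ t = trans (lincomb-lincomb bM γ t) (lincomb-cong γ↦ t)

        heavy-lincomb : ∀ t → lincomb γ t ∩ heavy ≡ lincomb h t
        heavy-lincomb = additive-lincomb (∩-additive heavy) γ

        ∈heavy : ∀ v {j} → lookup (v ∩ heavy) j ≡ true → lookup v j ≡ true × ∣ bM j ∣ ≡ w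
        ∈heavy v {j} j∈ = let v∋j , j-heavy = ∈-∩ v heavy j∈ in v∋j , Equivalence.to (∈-weightClass bM w j) j-heavy

        open SupportConnectivity (EQ.setoid (Gen G M)) bM

        items-touch : ∀ i → Touches (bN i) (items i)
        items-touch i j j∈ = expansion⇒closure (N , mcbN , ∈ₚ.∈-lookup i) (pivot (γ i) j (γ↦ i) j∈γᵢ)
          (ℕₚ.≤-antisym (ℕₚ.≤-trans (N-expansion-≤ i∈a) (ℕₚ.≤-reflexive (sym ∣bⱼ∣≡w))) (M-expansion-≤ j∈γᵢ))
          where
            i∈a×j∈hᵢ = ∈-· (lookup a i) (h i) j∈
            i∈a = proj₁ i∈a×j∈hᵢ
            j∈γᵢ = proj₁ (∈heavy (γ i) (proj₂ i∈a×j∈hᵢ))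
            ∣bⱼ∣≡w = proj₂ (∈heavy (γ i) (proj₂ i∈a×j∈hᵢ))

        x-touch : Touches x (lincomb γ a ∩ heavy)
        x-touch j j∈ = expansion⇒closure x-relevant
          (pivot (lincomb γ a) j (trans (lincomb-γ a) a↦x) (proj₁ (∈heavy (lincomb γ a) j∈)))
          (sym (proj₂ (∈heavy (lincomb γ a) j∈)))

        -- Otherwise the N-cycles selected by t sum to M-cycles shorter than w, whose N-expansions
        -- avoid bN p because |bN p| = w; yet t contains p.
        irreducible : ∀ s → lookup s p ≡ true → lincomb items s ≢ ∅
        irreducible s p∈s items↦∅ = ℕₚ.<-irrefl ∣bₚ∣≡w
          (ℕₚ.≤-<-trans (mcb-expansion-≤ (M.members j) (pivot (β j) p (β↦ j) p∈βⱼ) mcbN) (light j∈κ))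
          where
            t = s ∩ a
            κ = lincomb γ t
            no-heavy : κ ∩ heavy ≡ ∅
            no-heavy = trans (heavy-lincomb t) (trans (sym (lincomb-scaled a h s)) items↦∅)
            light : ∀ {j} → lookup κ j ≡ true → ∣ bM j ∣ < w
            light {j} j∈κ with ∈-lincomb γ t j j∈κ
            ... | i , i∈t , j∈γᵢ = ℕₚ.≤∧≢⇒< (ℕₚ.≤-trans (M-expansion-≤ j∈γᵢ) (N-expansion-≤ (proj₂ (∈-∩ s a i∈t))))
              λ ∣bⱼ∣≡w → ∅∌ j (trans (cong (λ v → lookup v j) (sym no-heavy))
                (trans (lookup-∩ κ heavy j) (cong₂ _∧_ j∈κ (Equivalence.from (∈-weightClass bM w j) ∣bⱼ∣≡w))))
            β : Fin (length M) → Subset (length N)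
            β j = proj₁ (N.generates (bM j) (M.members j))
            β↦ : ∀ j → lincomb bN (β j) ≡ bM j
            β↦ j = proj₂ (N.generates (bM j) (M.members j))
            t≡ : t ≡ lincomb β κ
            t≡ = lincomb-injective N.independent
              (sym (trans (trans (lincomb-lincomb bN β κ) (lincomb-cong β↦ κ)) (lincomb-γ t)))
            p∈t : lookup t p ≡ true
            p∈t = trans (lookup-∩ s a p) (cong₂ _∧_ p∈s (mcb-exchange-coefficient (proj₁ mcbN′) a a↦x))
            found = ∈-lincomb β κ p (trans (cong (λ v → lookup v p) (sym t≡)) p∈t)
            j = proj₁ found
            j∈κ = proj₁ (proj₂ found)
            p∈βⱼ = proj₂ (proj₂ found)

      exchange⇒closure : GenClosure G M x (bN p)
      exchange⇒closure = EQ.symmetric (Gen G M)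
        (connect-at items bN items-touch p (lincomb γ a ∩ heavy) x-touch (heavy-lincomb a) irreducible)

  -- From the generated closure to ∼pi

  steps : ∀ {B x y} → GenClosure G B x y → ℕ
  steps ε       = 0
  steps (_ ◅ r) = suc (steps r)

  steps-◅◅ : ∀ {B x y z} (r : GenClosure G B x y) (r′ : GenClosure G B y z) → steps (r ◅◅ r′) ≡ steps r + steps r′
  steps-◅◅ ε       r′ = refl
  steps-◅◅ (_ ◅ r) r′ = cong suc (steps-◅◅ r r′)

  module _ {B : List (EdgeSet G)} (mcb : IsMCB G B) where

    edge-relevant : ∀ {u v} → SymClosure (Gen G B) u v → Relevant G v
    edge-relevant (fwd g) = B , mcb , gen-∈ g
    edge-relevant (bwd g) = gen-relevant g

  edge-length : ∀ {B u v} → SymClosure (Gen G B) u v → ∣ u ∣ ≡ ∣ v ∣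
  edge-length (fwd g) = gen-length g
  edge-length (bwd g) = sym (gen-length g)

  module PathExchange {B : List (EdgeSet G)} (mcb : IsMCB G B) {X P : EdgeSet G} (g : Gen G B X P) where

    private
      b = List.lookup B
      module B = IsBasisOf (mcb-isBasisOf mcb)
      π = proj₁ (gen-expansion g)
      bₚ≡P = proj₂ (gen-expansion g)
      open Pivot π renaming (coefficients to c; index to p; expands to c↦X; uses to p∈c)
      open Exchange π using (b′; lincomb-exchanged; lincomb-exchangeCoefficients;
        lookup-exchangeCoefficients-p; lookup-exchangeCoefficients-≢)

    B′ : List (EdgeSet G)
    B′ = B [ p ]∷= X

    mcb′ : IsMCB G B′
    mcb′ = mcb-exchange (relevant⇒cycle (gen-relevant g)) π mcb (trans (gen-length g) (cong ∣_∣ (sym bₚ≡P)))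

    private
      B′≈b′ : B′ Represents b′
      B′≈b′ = represents-∷= B p X

      b′-p : b′ p ≡ X
      b′-p = Vectorₚ.updateAt-updates p b

      b′-≢ : ∀ {i} → i ≢ p → b′ i ≡ b i
      b′-≢ {i} i≢p = Vectorₚ.updateAt-minimal i p b i≢p

      index≡p : ∀ {i} → b i ≡ P → i ≡ p
      index≡p bᵢ≡P = independent⇒injective B.independent (trans bᵢ≡P (sym bₚ≡P))

      ∈B′ : ∀ {u} → u ∈ B′ → u ≡ X ⊎ ∃[ i ] i ≢ p × b i ≡ u
      ∈B′ u∈B′ with Equivalence.to (represents-∈ B′≈b′) u∈B′
      ... | i , b′ᵢ≡u with i Finₚ.≟ p
      ...   | yes refl = inj₁ (trans (sym b′ᵢ≡u) b′-p)
      ...   | no i≢p   = inj₂ (i , i≢p , trans (sym (b′-≢ i≢p)) b′ᵢ≡u)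

      ∉B⇒∉B′ : ∀ {u} → ¬ u ∈ B → u ≢ X → ¬ u ∈ B′
      ∉B⇒∉B′ u∉B u≢X u∈B′ with ∈B′ u∈B′
      ... | inj₁ u≡X            = u≢X u≡X
      ... | inj₂ (i , _ , bᵢ≡u) = u∉B (subst (_∈ B) bᵢ≡u (∈ₚ.∈-lookup i))

      kept-∈B′ : ∀ {i} → i ≢ p → b i ∈ B′
      kept-∈B′ {i} i≢p = Equivalence.from (represents-∈ B′≈b′) (i , b′-≢ i≢p)

      X∈B′ : X ∈ B′
      X∈B′ = Equivalence.from (represents-∈ B′≈b′) (p , b′-p)

      InExpansion-B′ : ∀ {u} (σ : Pivot b′ u) → InExpansion G B′ u (b′ (Pivot.index σ))
      InExpansion-B′ σ = Equivalence.from (represents-InExpansion B′≈b′) (σ , refl)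

    UsesP : EdgeSet G → Set
    UsesP u = ∃[ s ] lincomb b s ≡ u × lookup s p ≡ true

    InExpansionOfX : EdgeSet G → Set
    InExpansionOfX v = ∃[ i ] b i ≡ v × lookup c i ≡ true

    -- Only generating pairs at an affected vertex can be lost by the exchange.
    Affected : EdgeSet G → Set
    Affected u = u ≡ X ⊎ u ≡ P ⊎ UsesP u ⊎ InExpansionOfX u

    affected? : ∀ {u} → IsCycle G u → Dec (Affected u)
    affected? {u} u∈Z = (u ≟ᵉ X) ⊎-dec (u ≟ᵉ P) ⊎-dec usesP? ⊎-dec
      Finₚ.any? (λ i → (b i ≟ᵉ u) ×-dec (lookup c i Boolₚ.≟ true))
      where
        s₀ = proj₁ (B.generates u u∈Z)
        s₀↦u = proj₂ (B.generates u u∈Z)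
        usesP? : Dec (UsesP u)
        usesP? with lookup s₀ p Boolₚ.≟ true
        ... | yes p∈s₀ = yes (s₀ , s₀↦u , p∈s₀)
        ... | no p∉s₀  = no λ (s , s↦u , p∈s) →
          p∉s₀ (subst (λ v → lookup v p ≡ true)
            (lincomb-injective B.independent {s} {s₀} (trans s↦u (sym s₀↦u))) p∈s)

    gen-transfer : ∀ {u v} → Gen G B u v → u ≢ X → v ≢ P → ¬ UsesP u ⊎ ¬ InExpansionOfX v → Gen G B′ u v
    gen-transfer {u} g′ u≢X v≢P untouched =
      gen-relevant g′ , ∉B⇒∉B′ (gen-∉ g′) u≢X , subst (_∈ B′) bᵢ≡v (kept-∈B′ i≢p) ,
      subst (InExpansion G B′ u) (trans (b′-≢ i≢p) bᵢ≡v)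
        (InExpansion-B′ (pivot (exchangeCoefficients c p s) i (trans (lincomb-exchangeCoefficients s) s↦u) i∈s′)) ,
      gen-length g′
      where
        σ = proj₁ (gen-expansion g′)
        bᵢ≡v = proj₂ (gen-expansion g′)
        open Pivot σ renaming (coefficients to s; index to i; expands to s↦u; uses to i∈s)
        i≢p : i ≢ p
        i≢p i≡p = v≢P (trans (sym bᵢ≡v) (trans (cong b i≡p) bₚ≡P))
        untouched′ : lookup s p ∧ lookup c i ≡ false
        untouched′ = [ (λ ¬usesP → cong (_∧ lookup c i) (Boolₚ.¬-not λ p∈s → ¬usesP (s , s↦u , p∈s)))
                     , (λ ¬∈c → trans (cong (lookup s p ∧_) (Boolₚ.¬-not λ i∈c → ¬∈c (i , bᵢ≡v , i∈c)))
                                      (Boolₚ.∧-zeroʳ (lookup s p)))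
                     ]′ untouched
        i∈s′ : lookup (exchangeCoefficients c p s) i ≡ true
        i∈s′ = trans (lookup-exchangeCoefficients-≢ s i≢p)
          (trans (cong (lookup s i xor_) untouched′) (trans (Boolₚ.xor-identityʳ _) i∈s))

    transfer-edge : ∀ {u v} → SymClosure (Gen G B) u v → u ≢ X → u ≢ P → ¬ Affected v →
      SymClosure (Gen G B′) u v
    transfer-edge (fwd g) u≢X u≢P v-unaffected =
      fwd (gen-transfer g u≢X (v-unaffected ∘ inj₂ ∘ inj₁) (inj₂ (v-unaffected ∘ inj₂ ∘ inj₂ ∘ inj₂)))
    transfer-edge (bwd g) u≢X u≢P v-unaffected =
      bwd (gen-transfer g (v-unaffected ∘ inj₁) u≢P (inj₁ (v-unaffected ∘ inj₂ ∘ inj₂ ∘ inj₁)))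

    near : ∀ {w} → Affected w → Relevant G w → ∣ w ∣ ≡ ∣ X ∣ →
      (Σ[ r ∈ GenClosure G B X w ] steps r ≤ 1) ⊎ (Σ[ r ∈ GenClosure G B P w ] steps r ≤ 1)
    near (inj₁ refl)         _ _ = inj₁ (ε , z≤n)
    near (inj₂ (inj₁ refl))  _ _ = inj₂ (ε , z≤n)
    near {w} (inj₂ (inj₂ (inj₁ (s , s↦w , p∈s)))) w-relevant ∣w∣≡∣X∣ with w ∈? B
    ... | yes w∈B = inj₂ (subst (λ v → Σ[ r ∈ GenClosure G B P v ] steps r ≤ 1) P≡w (ε , z≤n))
      where
        i = proj₁ (Equivalence.to (∈⇔lookup {L = B}) w∈B)
        bᵢ≡w = proj₂ (Equivalence.to (∈⇔lookup {L = B}) w∈B)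
        p≡i = pivot-member B.independent (pivot s p (trans s↦w (sym bᵢ≡w)) p∈s)
        P≡w : P ≡ w
        P≡w = trans (sym bₚ≡P) (trans (cong b p≡i) bᵢ≡w)
    ... | no w∉B = inj₂ (bwd (mkGen w-relevant w∉B (gen-∈ g) (pivot s p s↦w p∈s , bₚ≡P)
      (trans ∣w∣≡∣X∣ (gen-length g))) ◅ ε , s≤s z≤n)
    near (inj₂ (inj₂ (inj₂ (i , bᵢ≡w , i∈c)))) _ ∣w∣≡∣X∣ = inj₁ (fwd (mkGen (gen-relevant g) (gen-∉ g)
      (subst (_∈ B) bᵢ≡w (∈ₚ.∈-lookup i)) (pivot c i c↦X i∈c , bᵢ≡w) (sym ∣w∣≡∣X∣)) ◅ ε , s≤s z≤n)

    reach : ∀ {y₀ w} → y₀ ≡ X ⊎ y₀ ≡ P → Affected w → Relevant G w → ∣ w ∣ ≡ ∣ X ∣ →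
      Σ[ r ∈ GenClosure G B y₀ w ] steps r ≤ 2
    reach anchor affected w-relevant ∣w∣≡∣X∣ with anchor | near affected w-relevant ∣w∣≡∣X∣
    ... | inj₁ refl | inj₁ (r , r≤1) = r , ℕₚ.m≤n⇒m≤1+n r≤1
    ... | inj₁ refl | inj₂ (r , r≤1) = fwd g ◅ r , s≤s r≤1
    ... | inj₂ refl | inj₁ (r , r≤1) = bwd g ◅ r , s≤s r≤1
    ... | inj₂ refl | inj₂ (r , r≤1) = r , ℕₚ.m≤n⇒m≤1+n r≤1

    scan : ∀ {u y} (r : GenClosure G B u y) → u ≢ X → u ≢ P →
      (∃[ w ] Affected w × Relevant G w × ∣ w ∣ ≡ ∣ u ∣ × Σ[ r′ ∈ GenClosure G B w y ] steps r′ < steps r)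
      ⊎ (Σ[ r′ ∈ GenClosure G B′ u y ] steps r′ ≡ steps r)
    scan ε _ _ = inj₂ (ε , refl)
    scan (e ◅ r) u≢X u≢P with affected? (relevant⇒cycle (edge-relevant mcb e))
    ... | yes affected = inj₁ (_ , affected , edge-relevant mcb e , sym (edge-length e) , r , ℕₚ.n<1+n (steps r))
    ... | no unaffected with scan r (unaffected ∘ inj₁) (unaffected ∘ inj₂ ∘ inj₁)
    ...   | inj₁ (w , affected , w-relevant , ∣w∣≡ , r′ , r′<r) =
      inj₁ (w , affected , w-relevant , trans ∣w∣≡ (sym (edge-length e)) , r′ , ℕₚ.m<n⇒m<1+n r′<r)
    ...   | inj₂ (r′ , r′≡r) = inj₂ (transfer-edge e u≢X u≢P unaffected ◅ r′ , cong suc r′≡r)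

    edge-to-X : ∀ {y} → Gen G B y P → y ≢ X → SymClosure (Gen G B′) X y
    edge-to-X {y} g′ y≢X = bwd (gen-relevant g′ , ∉B⇒∉B′ (gen-∉ g′) y≢X , X∈B′ ,
      subst (InExpansion G B′ y) b′-p (InExpansion-B′ (pivot (exchangeCoefficients c p s) p
        (trans (lincomb-exchangeCoefficients s) s↦y) (trans (lookup-exchangeCoefficients-p s) p∈s))) ,
      trans (gen-length g′) (sym (gen-length g)))
      where
        open Pivot (proj₁ (gen-expansion g′)) renaming (coefficients to s; index to i; expands to s↦y; uses to i∈s)
        p∈s : lookup s p ≡ true
        p∈s = subst (λ j → lookup s j ≡ true) (index≡p (proj₂ (gen-expansion g′))) i∈s

    edge-to-P : ∀ {y} → Gen G B X y → y ≢ P → SymClosure (Gen G B′) P y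
    edge-to-P {y} g′ y≢P = fwd ((B , mcb , gen-∈ g) , P∉B′ ,
      subst (_∈ B′) bᵢ≡y (kept-∈B′ i≢p) ,
      subst (InExpansion G B′ P) (trans (b′-≢ i≢p) bᵢ≡y)
        (InExpansion-B′ (pivot c i (trans lincomb-exchanged bₚ≡P) i∈c)) ,
      trans (sym (gen-length g)) (gen-length g′))
      where
        bᵢ≡y = proj₂ (gen-expansion g′)
        open Pivot (proj₁ (gen-expansion g′)) renaming (coefficients to s; index to i; expands to s↦X; uses to i∈s)
        i∈c : lookup c i ≡ true
        i∈c = subst (λ v → lookup v i ≡ true) (lincomb-injective B.independent {s} {c} (trans s↦X (sym c↦X))) i∈s
        i≢p : i ≢ p
        i≢p i≡p = y≢P (trans (sym bᵢ≡y) (trans (cong b i≡p) bₚ≡P))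
        P∉B′ : ¬ P ∈ B′
        P∉B′ P∈B′ with ∈B′ P∈B′
        ... | inj₁ P≡X            = gen-∉ g (subst (_∈ B) P≡X (gen-∈ g))
        ... | inj₂ (j , j≢p , bⱼ≡P) = j≢p (index≡p bⱼ≡P)

    shorten-via : ∀ {y₀ y₂ y} → y₀ ≡ X ⊎ y₀ ≡ P → SymClosure (Gen G B′) y₀ y₂ → y₂ ≢ X → y₂ ≢ P →
      ∣ y₂ ∣ ≡ ∣ X ∣ → (q : GenClosure G B y₂ y) →
      ∃[ B″ ] IsMCB G B″ × Σ[ r ∈ GenClosure G B″ y₀ y ] steps r < 2 + steps q
    shorten-via anchor new-edge y₂≢X y₂≢P ∣y₂∣≡∣X∣ q with scan q y₂≢X y₂≢P
    ... | inj₁ (w , affected , w-relevant , ∣w∣≡∣y₂∣ , q′ , q′<q)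
      with reach anchor affected w-relevant (trans ∣w∣≡∣y₂∣ ∣y₂∣≡∣X∣)
    ...   | r₀ , r₀≤2 =
      B , mcb , r₀ ◅◅ q′ , subst (_< 2 + steps q) (sym (steps-◅◅ r₀ q′)) (ℕₚ.+-mono-≤-< r₀≤2 q′<q)
    shorten-via anchor new-edge y₂≢X y₂≢P ∣y₂∣≡∣X∣ q | inj₂ (q′ , q′≡q) =
      B′ , mcb′ , new-edge ◅ q′ , s≤s (ℕₚ.≤-reflexive (cong suc q′≡q))

  shorten-turn : ∀ {B x y₁ y₂ y} → IsMCB G B → SymClosure (Gen G B) x y₁ → SymClosure (Gen G B) y₁ y₂ →
    y₂ ≢ x → (q : GenClosure G B y₂ y) →
    ∃[ B′ ] IsMCB G B′ × Σ[ r ∈ GenClosure G B′ x y ] steps r < 2 + steps q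
  shorten-turn {B} mcb (fwd g₁) (bwd g₂) y₂≢x q =
    shorten-via (inj₁ refl) (edge-to-X g₂ y₂≢x) y₂≢x y₂≢y₁ (trans (gen-length g₂) (sym (gen-length g₁))) q
    where
      open PathExchange mcb g₁
      y₂≢y₁ = λ y₂≡y₁ → gen-∉ g₂ (subst (_∈ B) (sym y₂≡y₁) (gen-∈ g₁))
  shorten-turn {B} mcb (bwd g₁) (fwd g₂) y₂≢x q =
    shorten-via (inj₂ refl) (edge-to-P g₂ y₂≢x) y₂≢y₁ y₂≢x (sym (gen-length g₂)) q
    where
      open PathExchange mcb g₁
      y₂≢y₁ = λ y₂≡y₁ → gen-∉ g₁ (subst (_∈ B) y₂≡y₁ (gen-∈ g₂))
  shorten-turn mcb (fwd g₁) (fwd g₂) _ _ = contradiction (gen-∈ g₁) (gen-∉ g₂)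
  shorten-turn mcb (bwd g₁) (bwd g₂) _ _ = contradiction (gen-∈ g₂) (gen-∉ g₁)

  shorten : ∀ {B x y} → IsMCB G B → (r : GenClosure G B x y) → 2 ≤ steps r →
    ∃[ B′ ] IsMCB G B′ × Σ[ r′ ∈ GenClosure G B′ x y ] steps r′ < steps r
  shorten {B} {x} mcb (_◅_ e₁ (_◅_ {j = y₂} e₂ q)) _ with y₂ ≟ᵉ x
  ... | yes refl = B , mcb , q , ℕₚ.m<n+m (steps q) (s≤s z≤n)
  ... | no y₂≢x  = shorten-turn mcb e₁ e₂ y₂≢x q
  shorten mcb (_ ◅ ε) (s≤s ())

  closure⇒∼pi-bounded : ∀ n {B x y} → IsMCB G B → Relevant G x → (r : GenClosure G B x y) → steps r ≤ n →
    _∼pi_ G x y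
  closure⇒∼pi-bounded _       mcb x-relevant ε           _ = ∼pi-refl x-relevant
  closure⇒∼pi-bounded _       mcb x-relevant (fwd g ◅ ε) _ = gen⇒∼pi mcb g
  closure⇒∼pi-bounded _       mcb x-relevant (bwd g ◅ ε) _ = ∼pi-sym (gen⇒∼pi mcb g)
  closure⇒∼pi-bounded zero    mcb x-relevant (_ ◅ _ ◅ _) ()
  closure⇒∼pi-bounded (suc n) mcb x-relevant r@(_ ◅ _ ◅ _) r≤1+n with shorten mcb r (s≤s (s≤s z≤n))
  ... | B′ , mcb′ , r′ , r′<r = closure⇒∼pi-bounded n mcb′ x-relevant r′ (ℕₚ.≤-pred (ℕₚ.≤-trans r′<r r≤1+n))

  closure⇒∼pi : ∀ {B x y} → IsMCB G B → Relevant G x → GenClosure G B x y → _∼pi_ G x y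
  closure⇒∼pi mcb x-relevant r = closure⇒∼pi-bounded (steps r) mcb x-relevant r ℕₚ.≤-refl

  ∼pi⇒closure : ∀ {M x y} → IsMCB G M → Relevant G x → _∼pi_ G x y → GenClosure G M x y
  ∼pi⇒closure mcbM x-relevant x∼y with ∼pi⇒∷= x∼y
  ... | N , p , mcbN , refl , mcbN′ = exchange⇒closure mcbM mcbN mcbN′ x-relevant

theorem2 : (G : Graph) (M : List (EdgeSet G)) → IsMCB G M →
    ((C₁ C₂ : EdgeSet G) → C₂ ∈ M → Relevant G C₁ → ¬ (C₁ ∈ M) →
      InExpansion G M C₁ C₂ → ∣ C₁ ∣ ≡ ∣ C₂ ∣ → _∼pi_ G C₁ C₂)
    × ((C D : EdgeSet G) → Relevant G C → Relevant G D →
      (_∼pi_ G C D ⇔ GenClosure G M C D))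
theorem2 G M mcb =
  (λ C₁ C₂ C₂∈M C₁-relevant C₁∉M C₂∈E ∣C₁∣≡∣C₂∣ →
    gen⇒∼pi mcb (C₁-relevant , C₁∉M , C₂∈M , C₂∈E , ∣C₁∣≡∣C₂∣)) ,
  λ C D C-relevant _ → mk⇔ (∼pi⇒closure mcb C-relevant) (closure⇒∼pi mcb C-relevant)
  where open CycleBases G
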